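{- Let $p$ be an odd prime and $n\ge1$. Let $\ell^0,\ell^1:\mathbb N_{\ge1}\to\mathbb N$ be functions and define $\tilde\lambda_k=p^{\ell^0_k}-p^{\ell^1_k}$ and $\lambda_k=\sum_{d\mid k}\mu(d)\tilde\lambda_{k/d}$ ($\mu$ the Möbius function). Suppose there are an integer $k_0\ge1$ coprime to $p$ and integers $0\le a\le b\le n$ such that for all $k\ge1$ $$\ell^0_k=e_{k_0}(k)\bigl(\min\{v(k)+a,n\}+\min\{v(k)+b,n\}\bigr),\quad \ell^1_k=e_{k_0}(k)\bigl(\min\{v(k)+a,n-1\}+\min\{v(k)+b,n-1\}\bigr).$$ If $a=b$, then $\lambda_k=0$ for $k\ne k_0p^{n-a}$ and $\lambda_{k_0p^{n-a}}=p^{2n}-p^{2n-2}$. If $a<b$, then $\lambda_k=0$ unless $k=k_0p^u$ with $n-b\le u\le n-a$, and $\lambda_{k_0p^{n-b}}=(p-1)p^{2n+a-b-1}$; $\lambda_{k_0p^u}=(p-1)^2p^{n+u+a-2}$ for $n-b<u<n-a$; $\lambda_{k_0p^{n-a}}=(p-1)p^{2n-1}$.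
   Context: $v$ is the $p$-adic valuation on positive integers; $e_{k_0}(k)$ equals $1$ if $k_0\mid k$ and $0$ otherwise. -}

module Defs where

open import Data.Nat using (ℕ; zero; suc; _+_; _*_; _∸_; _^_; _≤_; _<_)
open import Data.Nat.Divisibility using (_∣_; _∣?_; divides)
open import Data.Nat.Primality using (Prime; prime?)
open import Data.Nat.Properties using (_≟_)
open import Data.Integer as ℤ using (ℤ; +_; -_)
open import Data.List using (List; []; _∷_; upTo; filter; length; null)
open import Data.Bool using (Bool; true; false; if_then_else_)
open import Relation.Nullary using (Dec; yes; no; _×-dec_)

range1 : ℕ → List ℕ
range1 zero    = []
range1 (suc m) = suc m ∷ range1 m

-- p-adic valuation v_p(k) (for k ≥ 1, p ≥ 2); fuel k suffices since v_p(k) < k.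
val-go : ℕ → ℕ → ℕ → ℕ
val-go zero    p k = 0
val-go (suc f) p k with p ∣? k
... | yes (divides q _) = suc (val-go f p q)
... | no  _             = 0

val : ℕ → ℕ → ℕ
val p k = val-go k p k

e : ℕ → ℕ → ℕ
e k0 k with k0 ∣? k
... | yes _ = 1
... | no  _ = 0

primeDivisors : ℕ → List ℕ
primeDivisors d = filter (λ q → prime? q ×-dec (q ∣? d)) (range1 d)

squarePrimeDivisors : ℕ → List ℕ
squarePrimeDivisors d = filter (λ q → prime? q ×-dec ((q * q) ∣? d)) (range1 d)

μ : ℕ → ℤ
μ d = if null (squarePrimeDivisors d)
        then sign (length (primeDivisors d))
        else (ℤ.+ 0)
  where
  sign : ℕ → ℤ
  sign zero    = + 1
  sign (suc m) = - sign m

divSum-go : ℕ → ℕ → (ℕ → ℕ → ℤ) → ℤ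
divSum-go zero    k f = + 0
divSum-go (suc d) k f with suc d ∣? k
... | yes (divides q _) = f (suc d) q ℤ.+ divSum-go d k f
... | no  _             = divSum-go d k f

divSum : ℕ → (ℕ → ℕ → ℤ) → ℤ
divSum k f = divSum-go k k f

λ̃ : ℕ → (ℕ → ℕ) → (ℕ → ℕ) → ℕ → ℤ
λ̃ p ℓ⁰ ℓ¹ k = (+ (p ^ ℓ⁰ k)) ℤ.- (+ (p ^ ℓ¹ k))

λₖ : ℕ → (ℕ → ℕ) → (ℕ → ℕ) → ℕ → ℤ
λₖ p ℓ⁰ ℓ¹ k = divSum k (λ d q → μ d ℤ.* λ̃ p ℓ⁰ ℓ¹ q)

-- λ is the Möbius transform of λ̃, and λ̃ₖ depends only on whether k₀ ∣ k and on v(k); it vanishes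
-- when k₀ ∤ k, and then so does λₖ. For a prime q and K ≥ 1, splitting the divisors of qK by
-- whether q divides them gives λ(qK) = Σ_{y ∣ K, q ∤ y} μ(y) (λ̃(qK/y) − λ̃(K/y)). If q ≠ p and
-- k₀ ∣ K, multiplying K/y by q changes neither its valuation nor its divisibility by k₀, so every
-- bracket vanishes; hence λ is supported on the numbers k₀pʲ. For q = p and K = k₀pʲ only y = 1
-- survives, so λ(k₀) = g(0) and λ(k₀p^{j+1}) = g(j+1) − g(j) with g(j) = λ̃(k₀pʲ). By the min
-- formulas g(j) is 0 for j + b < n, p^{j+a+n} − p^{j+a+n−1} for j + a < n ≤ j + b, and
-- p^{2n} − p^{2n−2} for n ≤ j + a; the stated values are the differences of these.

module Submission where

open import Defs
open import Data.Nat using (ℕ; _+_; _*_; _∸_; _^_; _≤_; _<_; _⊓_)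
open import Data.Nat.Divisibility using (_∣_)
open import Data.Nat.Primality using (Prime)
open import Data.Nat.Coprimality using (Coprime)
open import Data.Integer using (ℤ; +_)
open import Data.Product using (_×_; ∃-syntax)
open import Relation.Binary.PropositionalEquality using (_≡_; _≢_)
open import Relation.Nullary using (¬_)

open import Data.Nat using (zero; suc; z≤n; s≤s; _<?_; _≤′_; ≤′-refl; ≤′-step; NonZero; >-nonZero; >-nonZero⁻¹;
  ≢-nonZero; ≢-nonZero⁻¹; nonTrivial⇒n>1; nonTrivial⇒≢1)
open import Data.Nat.Properties
open import Data.Nat.Divisibility using (divides; _∣?_; ∣-refl; ∣-trans; m∣m*n; ∣n⇒∣m*n; ∣m+n∣m⇒∣n; ∣⇒≤; ∣1⇒≡1;
  _∣0; *-cancelˡ-∣; *-monoʳ-∣)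
open import Data.Nat.Primality using (prime?; ¬prime[0]; ¬prime[1]; prime⇒nonZero; prime⇒nonTrivial; prime⇒irreducible;
  euclidsLemma)
open import Data.Nat.Coprimality using (coprime-divisor)
open import Data.Integer using (-_; _⊖_) renaming (_+_ to _+ℤ_; _-_ to _-ℤ_; _*_ to _*ℤ_)
import Data.Integer.Properties as ℤ
import Data.Integer.Tactic.RingSolver as ℤ-Solver
import Data.Nat.Tactic.RingSolver as ℕ-Solver
import Function.Properties.Equivalence as ⇔
open import Algebra.Properties.CommutativeSemigroup ℤ.+-commutativeSemigroup using (interchange)
open import Algebra.Properties.CommutativeSemigroup *-commutativeSemigroup using (x∙yz≈y∙xz; xy∙z≈y∙xz; xy∙z≈yz∙x)
open import Data.List using (List; []; _∷_; filter; length; null)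
open import Data.List.Properties using (filter-accept; filter-reject)
open import Data.Bool using (true; false)
open import Data.Product using (_,_; ∃₂)
open import Data.Sum using (_⊎_; inj₁; inj₂; [_,_]′)
open import Data.Empty using (⊥-elim)
open import Function using (id; _∘_)
open import Data.Nat.Induction using (<-rec)
open import Data.Nat.Primality.Factorisation using (factorise)
open import Data.List.Relation.Unary.All using (_∷_)
open import Data.Nat.ListAction using (product)
open import Function.Bundles using (_⇔_; mk⇔; Equivalence)
open import Relation.Nullary using (Dec; yes; no; contradiction; _×-dec_)
open import Relation.Unary using (Decidable)
open import Relation.Binary.PropositionalEquality using (refl; sym; trans; cong; cong₂; subst; module ≡-Reasoning)

∑ : ℕ → (ℕ → ℤ) → ℤ
∑ zero    f = + 0
∑ (suc n) f = f (suc n) +ℤ ∑ n f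

∑-cong : ∀ {f g : ℕ → ℤ} n → (∀ i → 1 ≤ i → i ≤ n → f i ≡ g i) → ∑ n f ≡ ∑ n g
∑-cong zero    f≡g = refl
∑-cong (suc n) f≡g =
  cong₂ _+ℤ_ (f≡g (suc n) (s≤s z≤n) ≤-refl) (∑-cong n (λ i 1≤i i≤n → f≡g i 1≤i (m≤n⇒m≤1+n i≤n)))

∑-distrib-+ : ∀ {f g : ℕ → ℤ} n → ∑ n (λ i → f i +ℤ g i) ≡ ∑ n f +ℤ ∑ n g
∑-distrib-+ zero    = refl
∑-distrib-+ {f} {g} (suc n) = trans (cong (f (suc n) +ℤ g (suc n) +ℤ_) (∑-distrib-+ n))
                            (interchange (f (suc n)) (g (suc n)) (∑ n f) (∑ n g))

∑-zero : ∀ {f : ℕ → ℤ} n → (∀ i → 1 ≤ i → i ≤ n → f i ≡ + 0) → ∑ n f ≡ + 0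
∑-zero zero    f≡0 = refl
∑-zero {f} (suc n) f≡0 rewrite f≡0 (suc n) (s≤s z≤n) ≤-refl =
  trans (ℤ.+-identityˡ (∑ n f)) (∑-zero n (λ i 1≤i i≤n → f≡0 i 1≤i (m≤n⇒m≤1+n i≤n)))

∑-truncate : ∀ {f : ℕ → ℤ} {m n} → m ≤ n → (∀ i → m < i → i ≤ n → f i ≡ + 0) → ∑ n f ≡ ∑ m f
∑-truncate {f} m≤n = go (≤⇒≤′ m≤n)
  where
  go : ∀ {m n} → m ≤′ n → (∀ i → m < i → i ≤ n → f i ≡ + 0) → ∑ n f ≡ ∑ m f
  go ≤′-refl           f≡0 = refl
  go (≤′-step {n} m≤n) f≡0 rewrite f≡0 (suc n) (s≤s (≤′⇒≤ m≤n)) ≤-refl =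
    trans (ℤ.+-identityˡ (∑ n f)) (go m≤n (λ i m<i i≤n → f≡0 i m<i (m≤n⇒m≤1+n i≤n)))

∑-first : ∀ {f : ℕ → ℤ} n → 1 ≤ n → (∀ i → 2 ≤ i → i ≤ n → f i ≡ + 0) → ∑ n f ≡ f 1
∑-first {f} n 1≤n f≡0 = trans (∑-truncate 1≤n f≡0) (ℤ.+-identityʳ (f 1))

∑-last : ∀ {f : ℕ → ℤ} m → (∀ i → 1 ≤ i → i ≤ m → f i ≡ + 0) → ∑ (suc m) f ≡ f (suc m)
∑-last {f} m f≡0 = trans (cong (f (suc m) +ℤ_) (∑-zero m f≡0)) (ℤ.+-identityʳ (f (suc m)))

∑-+ : ∀ {f : ℕ → ℤ} m n → ∑ (m + n) f ≡ ∑ m (λ i → f (n + i)) +ℤ ∑ n f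
∑-+ {f} zero    n = sym (ℤ.+-identityˡ (∑ n f))
∑-+ {f} (suc m) n = begin
  f (suc m + n) +ℤ ∑ (m + n) f                             ≡⟨ cong₂ _+ℤ_ (cong f (+-comm (suc m) n)) (∑-+ m n) ⟩
  f (n + suc m) +ℤ (∑ m (λ i → f (n + i)) +ℤ ∑ n f)       ≡⟨ ℤ.+-assoc (f (n + suc m)) _ _ ⟨
  f (n + suc m) +ℤ ∑ m (λ i → f (n + i)) +ℤ ∑ n f         ∎
  where open ≡-Reasoning

∑-multiples : ∀ {f : ℕ → ℤ} q .{{_ : NonZero q}} K → (∀ i → ¬ q ∣ i → f i ≡ + 0) →
              ∑ (q * K) f ≡ ∑ K (λ j → f (q * j))
∑-multiples q       zero    f≡0 rewrite *-zeroʳ q = refl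
∑-multiples {f} (suc q) (suc K) f≡0 = begin
  ∑ (suc q * suc K) f                                     ≡⟨ cong (λ m → ∑ m f) (*-suc (suc q) K) ⟩
  ∑ (suc q + suc q * K) f                                 ≡⟨ ∑-+ {f} (suc q) (suc q * K) ⟩
  ∑ (suc q) (λ i → f (suc q * K + i)) +ℤ ∑ (suc q * K) f  ≡⟨ cong₂ _+ℤ_ lastBlock (∑-multiples (suc q) K f≡0) ⟩
  f (suc q * suc K) +ℤ ∑ K (λ j → f (suc q * j))         ∎
  where
  open ≡-Reasoning
  lastBlock : ∑ (suc q) (λ i → f (suc q * K + i)) ≡ f (suc q * suc K)
  lastBlock = trans (∑-last q (λ i 1≤i i≤q → f≡0 _ (λ q∣ → <⇒≱ (s≤s i≤q)
                      (∣⇒≤ {{>-nonZero 1≤i}} (∣m+n∣m⇒∣n q∣ (m∣m*n K))))))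
                    (cong f (trans (+-comm (suc q * K) (suc q)) (sym (*-suc (suc q) K))))

prime∤⇒coprime : ∀ {q d} → Prime q → ¬ q ∣ d → Coprime d q
prime∤⇒coprime pq q∤d (i∣d , i∣q) with prime⇒irreducible pq i∣q
... | inj₁ i≡1 = i≡1
... | inj₂ refl = contradiction i∣d q∤d

prime∣prime⇒≡ : ∀ {q r} → Prime q → Prime r → r ∣ q → r ≡ q
prime∣prime⇒≡ pq pr r∣q with prime⇒irreducible pq r∣q
... | inj₁ refl = contradiction pr ¬prime[1]
... | inj₂ r≡q = r≡q

prime∤1 : ∀ {p} → Prime p → ¬ p ∣ 1
prime∤1 pp p∣1 = nonTrivial⇒≢1 {{prime⇒nonTrivial pp}} (∣1⇒≡1 p∣1)

prime∤coprime : ∀ {p k} → Prime p → Coprime k p → ¬ p ∣ k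
prime∤coprime {p} pp k⊥p p∣k = prime∤1 pp (subst (p ∣_) (k⊥p (p∣k , ∣-refl)) ∣-refl)

∣p^⇒≡1 : ∀ {p x} → Prime p → ¬ p ∣ x → ∀ j → x ∣ p ^ j → x ≡ 1
∣p^⇒≡1 pp p∤x zero    x∣1     = ∣1⇒≡1 x∣1
∣p^⇒≡1 pp p∤x (suc j) x∣p^1+j = ∣p^⇒≡1 pp p∤x j (coprime-divisor (prime∤⇒coprime pp p∤x) x∣p^1+j)

*≡*⇒∣⇔∣ : ∀ {a t c x} .{{_ : NonZero a}} .{{_ : NonZero x}} → a * t ≡ c * x → a ∣ c ⇔ x ∣ t
*≡*⇒∣⇔∣ {a} {t} {c} {x} at≡cx = mk⇔
  (λ { (divides s refl) → divides s (*-cancelˡ-≡ t (s * x) a (trans at≡cx (xy∙z≈y∙xz s a x))) })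
  (λ { (divides s refl) → divides s (*-cancelʳ-≡ c (s * a) x (trans (sym at≡cx) (sym (xy∙z≈y∙xz s a x)))) })

prime-factor : ∀ r → 1 < r → ∃₂ λ q s → Prime q × r ≡ q * s
prime-factor r 1<r with factorise r {{>-nonZero (<-trans (s≤s z≤n) 1<r)}}
... | record { factors = [] ; isFactorisation = r≡1 } = contradiction r≡1 (>⇒≢ 1<r)
... | record { factors = q ∷ qs ; isFactorisation = r≡qqs ; factorsPrime = pq ∷ _ } = q , product qs , pq , r≡qqs

n<m^n : ∀ {m} → 1 < m → ∀ n → n < m ^ n
n<m^n 1<m zero    = s≤s z≤n
n<m^n 1<m (suc n) = ≤-<-trans (n<m^n 1<m n) (^-monoʳ-< _ 1<m (n<1+n n))

p-power-decomposition : ∀ {p} → Prime p → ∀ m .{{_ : NonZero m}} → ∃₂ λ v r → m ≡ p ^ v * r × ¬ p ∣ r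
p-power-decomposition {p} pp = <-rec (λ m → .{{NonZero m}} → ∃₂ λ v r → m ≡ p ^ v * r × ¬ p ∣ r) step
  where
  instance _ = prime⇒nonZero pp
  step : ∀ m → (∀ {c} → c < m → .{{NonZero c}} → ∃₂ λ v r → c ≡ p ^ v * r × ¬ p ∣ r) →
         .{{NonZero m}} → ∃₂ λ v r → m ≡ p ^ v * r × ¬ p ∣ r
  step m rec with p ∣? m
  ... | no  p∤m             = 0 , m , sym (*-identityˡ m) , p∤m
  ... | yes (divides c refl) with rec {c} (m<m*n c p {{c≢0}} (nonTrivial⇒n>1 p {{prime⇒nonTrivial pp}})) {{c≢0}}
    where c≢0 = m*n≢0⇒m≢0 c
  ...   | v , r , refl , p∤r = suc v , r , sym (xy∙z≈yz∙x p (p ^ v) r) , p∤r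

val-go[p^v*r]≡v : ∀ {p r} → Prime p → ¬ p ∣ r → ∀ f v k → k ≡ p ^ v * r → v ≤ f → val-go f p k ≡ v
val-go[p^v*r]≡v pp p∤r zero    zero    k k≡ z≤n = refl
val-go[p^v*r]≡v {p} {r} pp p∤r (suc f) zero k k≡ _ with p ∣? k
... | yes p∣k = contradiction (subst (p ∣_) (trans k≡ (*-identityˡ r)) p∣k) p∤r
... | no  _   = refl
val-go[p^v*r]≡v {p} {r} pp p∤r (suc f) (suc v) k k≡ (s≤s v≤f) with p ∣? k
... | yes (divides q k≡qp) = cong suc (val-go[p^v*r]≡v pp p∤r f v q
        (*-cancelʳ-≡ q (p ^ v * r) p {{prime⇒nonZero pp}} (trans (sym k≡qp) k≡[p^v*r]*p)) v≤f)
  where k≡[p^v*r]*p = trans k≡ (xy∙z≈yz∙x p (p ^ v) r)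
... | no  p∤k = contradiction (divides (p ^ v * r) (trans k≡ (xy∙z≈yz∙x p (p ^ v) r))) p∤k

val[p^v*r]≡v : ∀ {p r} → Prime p → ¬ p ∣ r → ∀ v → val p (p ^ v * r) ≡ v
val[p^v*r]≡v {p} {r} pp p∤r v = val-go[p^v*r]≡v pp p∤r (p ^ v * r) v (p ^ v * r) refl
  (≤-trans (<⇒≤ (n<m^n (nonTrivial⇒n>1 p {{prime⇒nonTrivial pp}}) v)) (m≤m*n (p ^ v) r {{r≢0}}))
  where r≢0 = ≢-nonZero (λ { refl → p∤r (p ∣0) })

val[s*c]≡val[c] : ∀ {p s} → Prime p → ¬ p ∣ s → ∀ c .{{_ : NonZero c}} → val p (s * c) ≡ val p c
val[s*c]≡val[c] {p} {s} pp p∤s c with p-power-decomposition pp c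
... | v , r , refl , p∤r = begin
  val p (s * (p ^ v * r))   ≡⟨ cong (val p) (x∙yz≈y∙xz s (p ^ v) r) ⟩
  val p (p ^ v * (s * r))   ≡⟨ val[p^v*r]≡v pp p∤sr v ⟩
  v                         ≡⟨ val[p^v*r]≡v pp p∤r v ⟨
  val p (p ^ v * r)         ∎
  where
  open ≡-Reasoning
  p∤sr : ¬ p ∣ s * r
  p∤sr p∣sr = [ p∤s , p∤r ]′ (euclidsLemma s r pp p∣sr)

count : {P : ℕ → Set} → Decidable P → ℕ → ℕ
count P? N = length (filter P? (range1 N))

module _ {P : ℕ → Set} (P? : Decidable P) where

  count-accept : ∀ {N} → P (suc N) → count P? (suc N) ≡ suc (count P? N)
  count-accept pN = cong length (filter-accept P? pN)

  count-reject : ∀ {N} → ¬ P (suc N) → count P? (suc N) ≡ count P? N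
  count-reject ¬pN = cong length (filter-reject P? ¬pN)

  count-truncate : ∀ {M N} → M ≤ N → (∀ x → M < x → x ≤ N → ¬ P x) → count P? N ≡ count P? M
  count-truncate M≤N = go (≤⇒≤′ M≤N)
    where
    go : ∀ {M N} → M ≤′ N → (∀ x → M < x → x ≤ N → ¬ P x) → count P? N ≡ count P? M
    go ≤′-refl           ¬P = refl
    go (≤′-step {N} M≤N) ¬P = trans (count-reject (¬P (suc N) (s≤s (≤′⇒≤ M≤N)) ≤-refl))
                                    (go M≤N (λ x M<x x≤N → ¬P x M<x (m≤n⇒m≤1+n x≤N)))

  filter-range1-nonempty : ∀ {x} N → P x → 1 ≤ x → x ≤ N → null (filter P? (range1 N)) ≡ false
  filter-range1-nonempty zero    _  (s≤s _) ()
  filter-range1-nonempty {x} (suc N) px 1≤x x≤N with P? (suc N) | x ≟ suc N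
  ... | yes _   | _        = refl
  ... | no ¬pN | yes refl = contradiction px ¬pN
  ... | no _   | no x≢N   = filter-range1-nonempty N px 1≤x (≤-pred (≤∧≢⇒< x≤N x≢N))

module _ {P Q : ℕ → Set} (P? : Decidable P) (Q? : Decidable Q) where

  count-cong : ∀ N → (∀ x → 1 ≤ x → x ≤ N → P x ⇔ Q x) → count P? N ≡ count Q? N
  count-cong zero    P⇔Q = refl
  count-cong (suc N) P⇔Q = step (Q? (suc N))
    where
    open ≡-Reasoning
    open Equivalence (P⇔Q (suc N) (s≤s z≤n) ≤-refl)
    rec : count P? N ≡ count Q? N
    rec = count-cong N (λ x 1≤x x≤N → P⇔Q x 1≤x (m≤n⇒m≤1+n x≤N))
    step : Dec (Q (suc N)) → count P? (suc N) ≡ count Q? (suc N)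
    step (yes qN) = begin
      count P? (suc N)   ≡⟨ count-accept P? (from qN) ⟩
      suc (count P? N)   ≡⟨ cong suc rec ⟩
      suc (count Q? N)   ≡⟨ count-accept Q? qN ⟨
      count Q? (suc N)   ∎
    step (no ¬qN) = begin
      count P? (suc N)   ≡⟨ count-reject P? (¬qN ∘ to) ⟩
      count P? N         ≡⟨ rec ⟩
      count Q? N         ≡⟨ count-reject Q? ¬qN ⟨
      count Q? (suc N)   ∎

  count-insert : ∀ {q} N → 1 ≤ q → q ≤ N → ¬ Q q → (∀ x → 1 ≤ x → x ≤ N → P x ⇔ (Q x ⊎ x ≡ q)) →
                 count P? N ≡ suc (count Q? N)
  count-insert zero (s≤s _) ()
  count-insert {q} (suc N) 1≤q q≤N ¬qq P⇔Q⊎q with q ≟ suc N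
  ... | yes refl = begin
    count P? (suc N)     ≡⟨ count-accept P? (Equivalence.from (P⇔Q⊎q (suc N) 1≤q ≤-refl) (inj₂ refl)) ⟩
    suc (count P? N)     ≡⟨ cong suc (count-cong N below) ⟩
    suc (count Q? N)     ≡⟨ cong suc (count-reject Q? ¬qq) ⟨
    suc (count Q? (suc N)) ∎
    where
    open ≡-Reasoning
    below : ∀ x → 1 ≤ x → x ≤ N → P x ⇔ Q x
    below x 1≤x x≤N =
      mk⇔ (λ px → [ id , (λ x≡q → ⊥-elim (<-irrefl x≡q (s≤s x≤N))) ]′ (to px)) (from ∘ inj₁)
      where open Equivalence (P⇔Q⊎q x 1≤x (m≤n⇒m≤1+n x≤N))
  ... | no q≢N = step (Q? (suc N))
    where
    open ≡-Reasoning
    open Equivalence (P⇔Q⊎q (suc N) (s≤s z≤n) ≤-refl)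
    rec : count P? N ≡ suc (count Q? N)
    rec = count-insert N 1≤q (≤-pred (≤∧≢⇒< q≤N q≢N)) ¬qq
                       (λ x 1≤x x≤N → P⇔Q⊎q x 1≤x (m≤n⇒m≤1+n x≤N))
    step : Dec (Q (suc N)) → count P? (suc N) ≡ suc (count Q? (suc N))
    step (yes qN) = begin
      count P? (suc N)         ≡⟨ count-accept P? (from (inj₁ qN)) ⟩
      suc (count P? N)         ≡⟨ cong suc rec ⟩
      suc (suc (count Q? N))   ≡⟨ cong suc (count-accept Q? qN) ⟨
      suc (count Q? (suc N))   ∎
    step (no ¬qN) = begin
      count P? (suc N)         ≡⟨ count-reject P? (λ pN → [ ¬qN , q≢N ∘ sym ]′ (to pN)) ⟩
      count P? N               ≡⟨ rec ⟩
      suc (count Q? N)         ≡⟨ cong suc (count-reject Q? ¬qN) ⟨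
      suc (count Q? (suc N))   ∎

length≡⇒null≡ : ∀ (xs ys : List ℕ) → length xs ≡ length ys → null xs ≡ null ys
length≡⇒null≡ []      []      _ = refl
length≡⇒null≡ (_ ∷ _) (_ ∷ _) _ = refl

μ≡-μ : ∀ m d → length (squarePrimeDivisors m) ≡ length (squarePrimeDivisors d) →
         length (primeDivisors m) ≡ suc (length (primeDivisors d)) → μ m ≡ - μ d
μ≡-μ m d sq pd rewrite length≡⇒null≡ (squarePrimeDivisors m) (squarePrimeDivisors d) sq | pd
  with null (squarePrimeDivisors d)
... | true  = refl
... | false = refl

μ-square : ∀ {q d} .{{_ : NonZero d}} → Prime q → q * q ∣ d → μ d ≡ + 0
μ-square {q} {d} pq qq∣d
  rewrite filter-range1-nonempty (λ r → prime? r ×-dec (r * r ∣? d)) d (pq , qq∣d)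
            (>-nonZero⁻¹ q {{prime⇒nonZero pq}}) (≤-trans (m≤m*n q q {{prime⇒nonZero pq}}) (∣⇒≤ qq∣d)) = refl

μ-prime-* : ∀ {q d} .{{_ : NonZero d}} → Prime q → ¬ q ∣ d → μ (q * d) ≡ - μ d
μ-prime-* {q} {d} pq q∤d = μ≡-μ (q * d) d squares primes
  where
  instance _ = prime⇒nonZero pq
  SQ? : ∀ m → Decidable (λ r → Prime r × r * r ∣ m)
  SQ? m r = prime? r ×-dec (r * r ∣? m)
  PD? : ∀ m → Decidable (λ r → Prime r × r ∣ m)
  PD? m r = prime? r ×-dec (r ∣? m)

  sq⇔ : ∀ r → (Prime r × r * r ∣ q * d) ⇔ (Prime r × r * r ∣ d)
  sq⇔ r = mk⇔ to (λ (pr , rr∣d) → pr , ∣n⇒∣m*n q rr∣d)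
    where
    to : Prime r × r * r ∣ q * d → Prime r × r * r ∣ d
    to (pr , rr∣qd) with r ≟ q
    ... | yes refl = contradiction (*-cancelˡ-∣ q rr∣qd) q∤d
    ... | no r≢q   = pr , coprime-divisor (prime∤⇒coprime pq q∤rr) rr∣qd
      where
      q∤rr : ¬ q ∣ r * r
      q∤rr q∣rr = [ q≢r , q≢r ]′ (euclidsLemma r r pq q∣rr)
        where q≢r = λ q∣r → r≢q (sym (prime∣prime⇒≡ pr pq q∣r))

  pd⇔ : ∀ r → (Prime r × r ∣ q * d) ⇔ ((Prime r × r ∣ d) ⊎ r ≡ q)
  pd⇔ r = mk⇔ (λ (pr , r∣qd) →
                 [ inj₂ ∘ prime∣prime⇒≡ pq pr , inj₁ ∘ (pr ,_) ]′ (euclidsLemma q d pr r∣qd))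
              [ (λ (pr , r∣d) → pr , ∣n⇒∣m*n q r∣d) , (λ { refl → pq , m∣m*n d }) ]′

  d≤qd : d ≤ q * d
  d≤qd = m≤n*m d q

  squares : count (SQ? (q * d)) (q * d) ≡ count (SQ? d) d
  squares = trans (count-cong (SQ? (q * d)) (SQ? d) (q * d) (λ r _ _ → sq⇔ r))
                  (count-truncate (SQ? d) d≤qd (λ r d<r _ (pr , rr∣d) →
                    <⇒≱ d<r (≤-trans (m≤m*n r r {{prime⇒nonZero pr}}) (∣⇒≤ rr∣d))))

  primes : count (PD? (q * d)) (q * d) ≡ suc (count (PD? d) d)
  primes = trans (count-insert (PD? (q * d)) (PD? d) (q * d) (>-nonZero⁻¹ q) (m≤m*n q d)
                   (λ (_ , q∣d) → q∤d q∣d) (λ r _ _ → pd⇔ r))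
                 (cong suc (count-truncate (PD? d) d≤qd (λ r d<r _ (_ , r∣d) → <⇒≱ d<r (∣⇒≤ r∣d))))

skipMultiples : ℕ → (ℕ → ℤ) → ℕ → ℤ
skipMultiples q h x with q ∣? x
... | yes _ = + 0
... | no  _ = h x

skipMultiples-∣ : ∀ {q x} (h : ℕ → ℤ) → q ∣ x → skipMultiples q h x ≡ + 0
skipMultiples-∣ {q} {x} h q∣x with q ∣? x
... | yes _   = refl
... | no  q∤x = contradiction q∣x q∤x

skipMultiples-∤ : ∀ {q x} (h : ℕ → ℤ) → ¬ q ∣ x → skipMultiples q h x ≡ h x
skipMultiples-∤ {q} {x} h q∤x with q ∣? x
... | yes q∣x = contradiction q∣x q∤x
... | no  _   = refl

module MöbiusTransform (G : ℕ → ℤ) where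

  μ⋆G : ℕ → ℤ
  μ⋆G k = divSum k (λ d c → μ d *ℤ G c)

  term : ℕ → ℕ → ℤ
  term k x with x ∣? k
  ... | yes (divides c _) = μ x *ℤ G c
  ... | no  _             = + 0

  term-∣ : ∀ {k x c} .{{_ : NonZero x}} → k ≡ c * x → term k x ≡ μ x *ℤ G c
  term-∣ {k} {x} {c} k≡cx with x ∣? k
  ... | yes (divides c′ k≡c′x) = cong (λ c → μ x *ℤ G c) (*-cancelʳ-≡ c′ c x (trans (sym k≡c′x) k≡cx))
  ... | no  x∤k                = contradiction (divides c k≡cx) x∤k

  term-∤ : ∀ {k x} → ¬ x ∣ k → term k x ≡ + 0
  term-∤ {k} {x} x∤k with x ∣? k
  ... | yes x∣k = contradiction x∣k x∤k
  ... | no  _   = refl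

  term-1 : ∀ k → term k 1 ≡ G k
  term-1 k = trans (term-∣ {k} {1} {k} (sym (*-identityʳ k))) (ℤ.*-identityˡ (G k))

  term-G≡0 : ∀ {k x} .{{_ : NonZero k}} → (∀ c .{{_ : NonZero c}} → k ≡ c * x → G c ≡ + 0) → term k x ≡ + 0
  term-G≡0 {k} {x} Gc≡0 with x ∣? k
  ... | yes (divides c k≡cx) = trans (cong (μ x *ℤ_) (Gc≡0 c {{c≢0}} k≡cx)) (ℤ.*-zeroʳ (μ x))
    where c≢0 = ≢-nonZero (λ { refl → ≢-nonZero⁻¹ k k≡cx })
  ... | no  _                = refl

  μ⋆G≡∑ : ∀ k → μ⋆G k ≡ ∑ k (term k)
  μ⋆G≡∑ k = go k
    where
    go : ∀ d → divSum-go d k (λ d c → μ d *ℤ G c) ≡ ∑ d (term k)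
    go zero    = refl
    go (suc d) with suc d ∣? k
    ... | yes (divides c _) = cong (μ (suc d) *ℤ G c +ℤ_) (go d)
    ... | no  _             = trans (go d) (sym (ℤ.+-identityˡ _))

  term-μ≡0 : ∀ {k x} → μ x ≡ + 0 → term k x ≡ + 0
  term-μ≡0 {k} {x} μx≡0 with x ∣? k
  ... | yes (divides c _) = trans (cong (_*ℤ G c) μx≡0) (ℤ.*-zeroˡ (G c))
  ... | no  _             = refl

  term-prime-multiple : ∀ {q K y} .{{_ : NonZero y}} → Prime q →
                          term (q * K) (q * y) ≡ - skipMultiples q (term K) y
  term-prime-multiple {q} {K} {y} pq with q ∣? y
  ... | yes q∣y = term-μ≡0 {q * K} {q * y} (μ-square {{m*n≢0 q y}} pq (*-monoʳ-∣ q q∣y))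
    where instance _ = prime⇒nonZero pq
  ... | no  q∤y with y ∣? K
  ...   | yes (divides c K≡cy) = begin
    term (q * K) (q * y)   ≡⟨ term-∣ {{m*n≢0 q y}} (trans (cong (q *_) K≡cy) (x∙yz≈y∙xz q c y)) ⟩
    μ (q * y) *ℤ G c       ≡⟨ cong (_*ℤ G c) (μ-prime-* pq q∤y) ⟩
    - μ y *ℤ G c           ≡⟨ ℤ.neg-distribˡ-* (μ y) (G c) ⟨
    - (μ y *ℤ G c)         ∎
    where
    open ≡-Reasoning
    instance _ = prime⇒nonZero pq
  ...   | no  y∤K = term-∤ (y∤K ∘ *-cancelˡ-∣ q {{prime⇒nonZero pq}})

  -- The divisors of qK prime to q are those of K; a divisor q·y contributes 0 if q ∣ y (μ vanishes)
  -- and −μ(y) G(K/y) otherwise.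
  μ⋆G-prime-* : ∀ {q} K .{{_ : NonZero K}} → Prime q →
    μ⋆G (q * K) ≡ ∑ K (λ y → skipMultiples q (term (q * K)) y -ℤ skipMultiples q (term K) y)
  μ⋆G-prime-* {q} K pq = begin
    μ⋆G (q * K)                                               ≡⟨ μ⋆G≡∑ (q * K) ⟩
    ∑ (q * K) h                                               ≡⟨ ∑-cong (q * K) (λ x _ _ → split (h x) (skip h x)) ⟩
    ∑ (q * K) (λ x → skip h x +ℤ (h x -ℤ skip h x))           ≡⟨ ∑-distrib-+ (q * K) ⟩
    ∑ (q * K) (skip h) +ℤ ∑ (q * K) (λ x → h x -ℤ skip h x)  ≡⟨ cong₂ _+ℤ_ nonMultiples multiples ⟩
    ∑ K (skip h) +ℤ ∑ K (λ y → - skip (term K) y)            ≡⟨ ∑-distrib-+ K ⟨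
    ∑ K (λ y → skip h y -ℤ skip (term K) y)                  ∎
    where
    open ≡-Reasoning
    instance _ = prime⇒nonZero pq
    h = term (q * K)
    skip = skipMultiples q

    split : ∀ a b → a ≡ b +ℤ (a -ℤ b)
    split = ℤ-Solver.solve-∀

    nonMultiple-vanishes : ∀ x → K < x → skip h x ≡ + 0
    nonMultiple-vanishes x K<x with q ∣? x
    ... | yes _   = refl
    ... | no  q∤x = term-∤ (λ x∣qK → <⇒≱ K<x (∣⇒≤ (coprime-divisor (prime∤⇒coprime pq q∤x) x∣qK)))

    nonMultiples : ∑ (q * K) (skip h) ≡ ∑ K (skip h)
    nonMultiples = ∑-truncate (m≤n*m K q) (λ x K<x _ → nonMultiple-vanishes x K<x)

    multiples : ∑ (q * K) (λ x → h x -ℤ skip h x) ≡ ∑ K (λ y → - skip (term K) y)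
    multiples = begin
      ∑ (q * K) (λ x → h x -ℤ skip h x)
        ≡⟨ ∑-multiples q K (λ x q∤x → trans (cong (h x -ℤ_) (skipMultiples-∤ {q} h q∤x))
                                             (ℤ.+-inverseʳ (h x))) ⟩
      ∑ K (λ y → h (q * y) -ℤ skip h (q * y))
        ≡⟨ ∑-cong K (λ y 1≤y _ → trans (cong (h (q * y) -ℤ_) (skipMultiples-∣ {q} h (m∣m*n y)))
                                  (trans (ℤ.+-identityʳ _) (term-prime-multiple {q} {K} {y} {{>-nonZero 1≤y}} pq))) ⟩
      ∑ K (λ y → - skip (term K) y) ∎

e-∣ : ∀ {k₀ k} → k₀ ∣ k → e k₀ k ≡ 1
e-∣ {k₀} {k} k₀∣k with k₀ ∣? k
... | yes _   = refl
... | no  k₀∤k = contradiction k₀∣k k₀∤k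

e-∤ : ∀ {k₀ k} → ¬ k₀ ∣ k → e k₀ k ≡ 0
e-∤ {k₀} {k} k₀∤k with k₀ ∣? k
... | yes k₀∣k = contradiction k₀∣k k₀∤k
... | no  _    = refl

e-cong : ∀ {k₀ y z} → k₀ ∣ y ⇔ k₀ ∣ z → e k₀ y ≡ e k₀ z
e-cong {k₀} {y} {z} y⇔z with k₀ ∣? y
... | yes k₀∣y = sym (e-∣ (Equivalence.to y⇔z k₀∣y))
... | no  k₀∤y = sym (e-∤ (k₀∤y ∘ Equivalence.from y⇔z))

Δ : (ℕ → ℤ) → ℕ → ℤ
Δ g zero    = g zero
Δ g (suc j) = g (suc j) -ℤ g j

Δ-after-zero : ∀ {g} j → (∀ i → suc i ≡ j → g i ≡ + 0) → Δ g j ≡ g j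
Δ-after-zero zero    _      = refl
Δ-after-zero {g} (suc i) g[i]≡0 = trans (cong (g (suc i) -ℤ_) (g[i]≡0 i refl)) (ℤ.+-identityʳ (g (suc i)))

module Profile {p} (pp : Prime p) {k₀} .{{k₀≢0 : NonZero k₀}} (p∤k₀ : ¬ p ∣ k₀) (L⁰ L¹ : ℕ → ℕ)
               {ℓ⁰ ℓ¹ : ℕ → ℕ} (ℓ⁰≡ : ∀ k → 1 ≤ k → ℓ⁰ k ≡ e k₀ k * L⁰ (val p k))
               (ℓ¹≡ : ∀ k → 1 ≤ k → ℓ¹ k ≡ e k₀ k * L¹ (val p k)) where

  open MöbiusTransform (λ̃ p ℓ⁰ ℓ¹)

  g : ℕ → ℤ
  g j = + (p ^ L⁰ j) -ℤ + (p ^ L¹ j)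

  private instance
    p≢0 = prime⇒nonZero pp

  k₀p^j≢0 : ∀ j → NonZero (k₀ * p ^ j)
  k₀p^j≢0 j = m*n≢0 k₀ (p ^ j) {{k₀≢0}} {{m^n≢0 p j}}

  λ̃≡0 : ∀ {k} .{{_ : NonZero k}} → ¬ k₀ ∣ k → λ̃ p ℓ⁰ ℓ¹ k ≡ + 0
  λ̃≡0 {k} k₀∤k rewrite ℓ⁰≡ k (>-nonZero⁻¹ k) | ℓ¹≡ k (>-nonZero⁻¹ k) | e-∤ k₀∤k = refl

  λ̃-cong : ∀ {y z} .{{_ : NonZero y}} .{{_ : NonZero z}} → k₀ ∣ y ⇔ k₀ ∣ z → val p y ≡ val p z →
           λ̃ p ℓ⁰ ℓ¹ y ≡ λ̃ p ℓ⁰ ℓ¹ z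
  λ̃-cong {y} {z} y⇔z vy≡vz rewrite ℓ⁰≡ y (>-nonZero⁻¹ y) | ℓ¹≡ y (>-nonZero⁻¹ y)
                                 | ℓ⁰≡ z (>-nonZero⁻¹ z) | ℓ¹≡ z (>-nonZero⁻¹ z) | e-cong y⇔z | vy≡vz = refl

  val[k₀p^j]≡j : ∀ j → val p (k₀ * p ^ j) ≡ j
  val[k₀p^j]≡j j = begin
    val p (k₀ * p ^ j)       ≡⟨ val[s*c]≡val[c] pp p∤k₀ (p ^ j) {{m^n≢0 p j}} ⟩
    val p (p ^ j)            ≡⟨ cong (val p) (*-identityʳ (p ^ j)) ⟨
    val p (p ^ j * 1)        ≡⟨ val[p^v*r]≡v pp (prime∤1 pp) j ⟩
    j                        ∎
    where open ≡-Reasoning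

  λ̃[k₀p^j]≡g : ∀ j → λ̃ p ℓ⁰ ℓ¹ (k₀ * p ^ j) ≡ g j
  λ̃[k₀p^j]≡g j rewrite ℓ⁰≡ (k₀ * p ^ j) (>-nonZero⁻¹ _ {{k₀p^j≢0 j}})
                      | ℓ¹≡ (k₀ * p ^ j) (>-nonZero⁻¹ _ {{k₀p^j≢0 j}})
                      | e-∣ {k₀} (m∣m*n {k₀} (p ^ j)) | val[k₀p^j]≡j j
                      | +-identityʳ (L⁰ j) | +-identityʳ (L¹ j) = refl

  term[k₀p^j]≡0 : ∀ j x .{{_ : NonZero x}} → ¬ x ∣ p ^ j → term (k₀ * p ^ j) x ≡ + 0
  term[k₀p^j]≡0 j x x∤p^j = term-G≡0 {{k₀p^j≢0 j}} (λ c k₀p^j≡cx →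
    λ̃≡0 (x∤p^j ∘ Equivalence.to (*≡*⇒∣⇔∣ {{k₀≢0}} k₀p^j≡cx)))

  λₖ≡0-off-k₀ : ∀ {k} .{{_ : NonZero k}} → ¬ k₀ ∣ k → λₖ p ℓ⁰ ℓ¹ k ≡ + 0
  λₖ≡0-off-k₀ {k} k₀∤k = trans (μ⋆G≡∑ k) (∑-zero k (λ x _ _ → term-G≡0 (λ c k≡cx →
    λ̃≡0 (λ k₀∣c → k₀∤k (∣-trans k₀∣c (divides x (trans k≡cx (*-comm c x))))))))

  λₖ[k₀p^j]≡Δg : ∀ j → λₖ p ℓ⁰ ℓ¹ (k₀ * p ^ j) ≡ Δ g j
  λₖ[k₀p^j]≡Δg zero = begin
    μ⋆G (k₀ * 1)       ≡⟨ μ⋆G≡∑ (k₀ * 1) ⟩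
    ∑ (k₀ * 1) (term (k₀ * 1))
      ≡⟨ ∑-first (k₀ * 1) (>-nonZero⁻¹ _ {{k₀p^j≢0 0}}) (λ x 2≤x _ →
           term[k₀p^j]≡0 0 x {{>-nonZero (<-trans (s≤s z≤n) 2≤x)}} (λ x∣1 → <⇒≢ 2≤x (sym (∣1⇒≡1 x∣1)))) ⟩
    term (k₀ * 1) 1    ≡⟨ term-1 (k₀ * 1) ⟩
    λ̃ p ℓ⁰ ℓ¹ (k₀ * 1) ≡⟨ λ̃[k₀p^j]≡g 0 ⟩
    g 0                ∎
    where open ≡-Reasoning
  λₖ[k₀p^j]≡Δg (suc j) = begin
    μ⋆G (k₀ * p ^ suc j)    ≡⟨ cong μ⋆G k₀p^1+j≡p*K ⟩
    μ⋆G (p * K)             ≡⟨ μ⋆G-prime-* K {{k₀p^j≢0 j}} pp ⟩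
    ∑ K (λ y → skip (term (p * K)) y -ℤ skip (term K) y)
      ≡⟨ ∑-first K (>-nonZero⁻¹ K {{k₀p^j≢0 j}}) (λ y 2≤y _ → vanishes-beyond-1 y 2≤y) ⟩
    skip (term (p * K)) 1 -ℤ skip (term K) 1
      ≡⟨ cong₂ _-ℤ_ (skipMultiples-∤ {p} (term (p * K)) (prime∤1 pp))
                    (skipMultiples-∤ {p} (term K) (prime∤1 pp)) ⟩
    term (p * K) 1 -ℤ term K 1
      ≡⟨ cong₂ _-ℤ_ (term-1 (p * K)) (term-1 K) ⟩
    λ̃ p ℓ⁰ ℓ¹ (p * K) -ℤ λ̃ p ℓ⁰ ℓ¹ K
      ≡⟨ cong₂ _-ℤ_ (trans (cong (λ̃ p ℓ⁰ ℓ¹) (sym k₀p^1+j≡p*K)) (λ̃[k₀p^j]≡g (suc j))) (λ̃[k₀p^j]≡g j) ⟩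
    g (suc j) -ℤ g j        ∎
    where
    open ≡-Reasoning
    K = k₀ * p ^ j
    skip = skipMultiples p
    k₀p^1+j≡p*K : k₀ * p ^ suc j ≡ p * K
    k₀p^1+j≡p*K = x∙yz≈y∙xz k₀ p (p ^ j)
    vanishes-beyond-1 : ∀ y → 2 ≤ y → skip (term (p * K)) y -ℤ skip (term K) y ≡ + 0
    vanishes-beyond-1 y 2≤y with p ∣? y
    ... | yes _   = refl
    ... | no  p∤y = cong₂ _-ℤ_
      (trans (cong (λ k → term k y) (sym k₀p^1+j≡p*K)) (term[k₀p^j]≡0 (suc j) y (y∤p^ (suc j))))
      (term[k₀p^j]≡0 j y (y∤p^ j))
      where
      instance _ = >-nonZero (<-trans (s≤s z≤n) 2≤y)
      y∤p^ : ∀ i → ¬ y ∣ p ^ i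
      y∤p^ i y∣p^i = <⇒≢ 2≤y (sym (∣p^⇒≡1 pp p∤y i y∣p^i))

  λₖ≡0-other-prime : ∀ {q} m .{{_ : NonZero m}} → Prime q → q ≢ p → λₖ p ℓ⁰ ℓ¹ (q * (k₀ * m)) ≡ + 0
  λₖ≡0-other-prime {q} m pq q≢p = trans (μ⋆G-prime-* K pq) (∑-zero K (λ y _ _ → cancels y))
    where
    instance
      _ = prime⇒nonZero pq
      K≢0 = m*n≢0 k₀ m {{k₀≢0}}
    K = k₀ * m

    p∤q : ¬ p ∣ q
    p∤q p∣q = q≢p (sym (prime∣prime⇒≡ pq pp p∣q))

    term-q*K≡term-K : ∀ {y} → ¬ q ∣ y → term (q * K) y ≡ term K y
    term-q*K≡term-K {y} q∤y with y ∣? K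
    ... | yes (divides c K≡cy) = begin
      term (q * K) y
        ≡⟨ term-∣ {{y≢0}} qK≡qc*y ⟩
      μ y *ℤ λ̃ p ℓ⁰ ℓ¹ (q * c)
        ≡⟨ cong (μ y *ℤ_) (λ̃-cong {{m*n≢0 q c}} k₀∣qc⇔k₀∣c (val[s*c]≡val[c] pp p∤q c)) ⟩
      μ y *ℤ λ̃ p ℓ⁰ ℓ¹ c ∎
      where
      open ≡-Reasoning
      y≢0 = ≢-nonZero (λ { refl → ≢-nonZero⁻¹ K (trans K≡cy (*-zeroʳ c)) })
      instance c≢0 = ≢-nonZero (λ { refl → ≢-nonZero⁻¹ K K≡cy })
      qK≡qc*y : q * K ≡ q * c * y
      qK≡qc*y = trans (cong (q *_) K≡cy) (sym (*-assoc q c y))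
      k₀∣qc⇔k₀∣c : k₀ ∣ q * c ⇔ k₀ ∣ c
      k₀∣qc⇔k₀∣c = ⇔.trans (*≡*⇒∣⇔∣ {{k₀≢0}} {{y≢0}} (trans (x∙yz≈y∙xz k₀ q m) qK≡qc*y))
                   (⇔.trans (mk⇔ (coprime-divisor (prime∤⇒coprime pq q∤y)) (∣n⇒∣m*n q))
                            (⇔.sym (*≡*⇒∣⇔∣ {{k₀≢0}} {{y≢0}} K≡cy)))
    ... | no y∤K = term-∤ (y∤K ∘ coprime-divisor (prime∤⇒coprime pq q∤y))

    cancels : ∀ y → skipMultiples q (term (q * K)) y -ℤ skipMultiples q (term K) y ≡ + 0
    cancels y with q ∣? y
    ... | yes _   = refl
    ... | no  q∤y = trans (cong (_-ℤ term K y) (term-q*K≡term-K q∤y)) (ℤ.+-inverseʳ (term K y))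

  λₖ-support : ∀ k .{{_ : NonZero k}} → λₖ p ℓ⁰ ℓ¹ k ≡ + 0 ⊎ ∃[ j ] k ≡ k₀ * p ^ j
  λₖ-support k with k₀ ∣? k
  ... | no  k₀∤k = inj₁ (λₖ≡0-off-k₀ k₀∤k)
  ... | yes (divides m refl) with p-power-decomposition pp m {{m*n≢0⇒m≢0 m}}
  ...   | v , r , refl , p∤r with r ≟ 1
  ...     | yes refl = inj₂ (v , trans (*-comm (p ^ v * 1) k₀) (cong (k₀ *_) (*-identityʳ (p ^ v))))
  ...     | no  r≢1  with prime-factor r (≤∧≢⇒< (>-nonZero⁻¹ r {{r≢0}}) (r≢1 ∘ sym))
    where r≢0 = ≢-nonZero (λ { refl → p∤r (p ∣0) })
  ...       | q , s , pq , refl = inj₁ (trans (cong μ⋆G (rearrange (p ^ v) q s k₀))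
                                             (λₖ≡0-other-prime (p ^ v * s) {{p^v*s≢0}} pq q≢p))
    where
    q≢p : q ≢ p
    q≢p refl = p∤r (m∣m*n s)
    p^v*s≢0 = m*n≢0 (p ^ v) s {{m^n≢0 p v}} {{≢-nonZero (λ { refl → p∤r (divides 0 (*-zeroʳ q)) })}}
    rearrange : ∀ x q s k₀ → x * (q * s) * k₀ ≡ q * (k₀ * (x * s))
    rearrange = ℕ-Solver.solve-∀

  λₖ≡0-unless-Δg : ∀ k .{{_ : NonZero k}} → (∀ j → k ≡ k₀ * p ^ j → Δ g j ≡ + 0) →
                   λₖ p ℓ⁰ ℓ¹ k ≡ + 0
  λₖ≡0-unless-Δg k Δg≡0 with λₖ-support k
  ... | inj₁ λₖ≡0            = λₖ≡0
  ... | inj₂ (j , k≡k₀p^j) =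
    trans (cong (λₖ p ℓ⁰ ℓ¹) k≡k₀p^j) (trans (λₖ[k₀p^j]≡Δg j) (Δg≡0 j k≡k₀p^j))


-- p and n are passed as successors so that p ∸ 1 and n ∸ 1 reduce to p′ and n′.
module MinProfile (p′ n′ a b : ℕ) (a≤b : a ≤ b) (b≤n : b ≤ suc n′) where

  p n : ℕ
  p = suc p′
  n = suc n′

  L⁰ L¹ : ℕ → ℕ
  L⁰ j = (j + a) ⊓ n + (j + b) ⊓ n
  L¹ j = (j + a) ⊓ n′ + (j + b) ⊓ n′

  g : ℕ → ℤ
  g = λ̃ p L⁰ L¹

  g≡ : ∀ j {e f} → L⁰ j ≡ e → L¹ j ≡ f → g j ≡ + (p ^ e) -ℤ + (p ^ f)
  g≡ j = cong₂ (λ e f → + (p ^ e) -ℤ + (p ^ f))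

  g-low : ∀ j → j + b ≤ n′ → g j ≡ + 0
  g-low j j+b≤n′ =
    trans (g≡ j (cong₂ _+_ (m≤n⇒m⊓n≡m (m≤n⇒m≤1+n j+a≤n′)) (m≤n⇒m⊓n≡m (m≤n⇒m≤1+n j+b≤n′)))
                (cong₂ _+_ (m≤n⇒m⊓n≡m j+a≤n′) (m≤n⇒m⊓n≡m j+b≤n′)))
          (ℤ.+-inverseʳ (+ (p ^ (j + a + (j + b)))))
    where j+a≤n′ = ≤-trans (+-monoʳ-≤ j a≤b) j+b≤n′

  g-mid : ∀ j → j + a ≤ n′ → n ≤ j + b → g j ≡ + (p ^ (j + a + n)) -ℤ + (p ^ (j + a + n′))
  g-mid j j+a≤n′ n≤j+b = g≡ j (cong₂ _+_ (m≤n⇒m⊓n≡m (m≤n⇒m≤1+n j+a≤n′)) (m≥n⇒m⊓n≡n n≤j+b))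
                            (cong₂ _+_ (m≤n⇒m⊓n≡m j+a≤n′) (m≥n⇒m⊓n≡n (≤-trans (n≤1+n n′) n≤j+b)))

  g-high : ∀ j → n ≤ j + a → g j ≡ + (p ^ (n + n)) -ℤ + (p ^ (n′ + n′))
  g-high j n≤j+a =
    g≡ j (cong₂ _+_ (m≥n⇒m⊓n≡n n≤j+a) (m≥n⇒m⊓n≡n n≤j+b))
         (cong₂ _+_ (m≥n⇒m⊓n≡n (≤-trans (n≤1+n n′) n≤j+a)) (m≥n⇒m⊓n≡n (≤-trans (n≤1+n n′) n≤j+b)))
    where n≤j+b = ≤-trans n≤j+a (+-monoʳ-≤ j a≤b)

  private
    a≤n : a ≤ n
    a≤n = ≤-trans a≤b b≤n

    <∸⇒+≤ : ∀ {j c} → c ≤ n → j < n ∸ c → j + c ≤ n′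
    <∸⇒+≤ c≤n j<n∸c = ≤-pred (m≤o∸n⇒m+n≤o (suc _) c≤n j<n∸c)

    ∸≤⇒≤+ : ∀ {j c} → n ∸ c ≤ j → n ≤ j + c
    ∸≤⇒≤+ {j} {c} n∸c≤j =
      ≤-trans (m≤n+m∸n n c) (≤-trans (+-monoʳ-≤ c n∸c≤j) (≤-reflexive (+-comm c j)))

    p*x-x : ∀ x → + (p * x) -ℤ + x ≡ + (p′ * x)
    p*x-x x = trans (cong (_-ℤ + x) (ℤ.pos-+ x (p′ * x))) (X+Y-X≡Y (+ x) (+ (p′ * x)))
      where
      X+Y-X≡Y : ∀ X Y → X +ℤ Y -ℤ X ≡ Y
      X+Y-X≡Y = ℤ-Solver.solve-∀

  Δg≡0-below : ∀ j → j < n ∸ b → Δ g j ≡ + 0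
  Δg≡0-below j j<n∸b = trans (Δ-after-zero j (λ { i refl → g-low i (≤-trans (n≤1+n (i + b)) j+b≤n′) }))
                             (g-low j j+b≤n′)
    where j+b≤n′ = <∸⇒+≤ b≤n j<n∸b

  Δg≡0-above : ∀ j → n ∸ a < j → Δ g j ≡ + 0
  Δg≡0-above (suc i) n∸a<1+i = trans (cong₂ _-ℤ_ (g-high (suc i) (≤-trans n≤i+a (n≤1+n _))) (g-high i n≤i+a))
                                     (ℤ.+-inverseʳ (+ (p ^ (n + n)) -ℤ + (p ^ (n′ + n′))))
    where n≤i+a = ∸≤⇒≤+ (≤-pred n∸a<1+i)

  Δg≡0-outside : ∀ j → ¬ (n ∸ b ≤ j × j ≤ n ∸ a) → Δ g j ≡ + 0
  Δg≡0-outside j ∉range with j <? n ∸ b | n ∸ a <? j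
  ... | yes j<n∸b | _         = Δg≡0-below j j<n∸b
  ... | no  _     | yes n∸a<j = Δg≡0-above j n∸a<j
  ... | no  j≮n∸b | no  n∸a≮j = contradiction (≮⇒≥ j≮n∸b , ≮⇒≥ n∸a≮j) ∉range

  Δg-equal : a ≡ b → Δ g (n ∸ a) ≡ + (p ^ (2 * n) ∸ p ^ (2 * n ∸ 2))
  Δg-equal refl = begin
    Δ g (n ∸ a)
      ≡⟨ Δ-after-zero (n ∸ a) (λ i 1+i≡n∸a → g-low i (≤-reflexive (i+a≡n′ 1+i≡n∸a))) ⟩
    g (n ∸ a)
      ≡⟨ g-high (n ∸ a) (≤-reflexive (sym (m∸n+n≡m a≤n))) ⟩
    + (p ^ (n + n)) -ℤ + (p ^ (n′ + n′))
      ≡⟨ ℤ.m-n≡m⊖n (p ^ (n + n)) (p ^ (n′ + n′)) ⟩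
    p ^ (n + n) ⊖ p ^ (n′ + n′)
      ≡⟨ ℤ.⊖-≥ (^-monoʳ-≤ p (+-mono-≤ (n≤1+n n′) (n≤1+n n′))) ⟩
    + (p ^ (n + n) ∸ p ^ (n′ + n′))
      ≡⟨ cong₂ (λ e f → + (p ^ e ∸ p ^ f)) 2n≡n+n 2n∸2≡n′+n′ ⟨
    + (p ^ (2 * n) ∸ p ^ (2 * n ∸ 2)) ∎
    where
    open ≡-Reasoning
    i+a≡n′ : ∀ {i} → suc i ≡ n ∸ a → i + a ≡ n′
    i+a≡n′ 1+i≡n∸a = suc-injective (trans (cong (_+ a) 1+i≡n∸a) (m∸n+n≡m a≤n))
    2n≡n+n : 2 * n ≡ n + n
    2n≡n+n = cong (λ t → n + t) (+-identityʳ n)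
    2n∸2≡n′+n′ : 2 * n ∸ 2 ≡ n′ + n′
    2n∸2≡n′+n′ = trans (cong (_∸ 1) (+-suc n′ (n′ + 0))) (cong (λ t → n′ + t) (+-identityʳ n′))

  Δg-first : a < b → Δ g (n ∸ b) ≡ + (p′ * p ^ (2 * n + a ∸ b ∸ 1))
  Δg-first a<b = begin
    Δ g j                                     ≡⟨ Δ-after-zero j (λ i 1+i≡j → g-low i (≤-reflexive (suc-injective
                                                   (trans (cong (_+ b) 1+i≡j) j+b≡n)))) ⟩
    g j                                       ≡⟨ g-mid j j+a≤n′ (≤-reflexive (sym j+b≡n)) ⟩
    + (p ^ (j + a + n)) -ℤ + (p ^ E)          ≡⟨ cong (λ e → + (p ^ e) -ℤ + (p ^ E)) (+-suc (j + a) n′) ⟩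
    + (p * p ^ E) -ℤ + (p ^ E)                ≡⟨ p*x-x (p ^ E) ⟩
    + (p′ * p ^ E)                            ≡⟨ cong (λ e → + (p′ * p ^ e)) exponent ⟨
    + (p′ * p ^ (2 * n + a ∸ b ∸ 1))          ∎
    where
    open ≡-Reasoning
    j = n ∸ b
    E = j + a + n′
    j+b≡n : j + b ≡ n
    j+b≡n = m∸n+n≡m b≤n
    j+a≤n′ : j + a ≤ n′
    j+a≤n′ = ≤-pred (≤-trans (+-monoʳ-< j a<b) (≤-reflexive j+b≡n))
    exponent : 2 * n + a ∸ b ∸ 1 ≡ E
    exponent = begin
      2 * n + a ∸ b ∸ 1      ≡⟨ cong (λ t → t ∸ b ∸ 1) 2n+a≡b+1+E ⟩
      b + suc E ∸ b ∸ 1      ≡⟨ cong (_∸ 1) (m+n∸m≡n b (suc E)) ⟩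
      E                      ∎
      where
      rearrange : ∀ j b n′ a → j + b + suc n′ + a ≡ b + suc (j + a + n′)
      rearrange = ℕ-Solver.solve-∀
      2n+a≡b+1+E : 2 * n + a ≡ b + suc E
      2n+a≡b+1+E = begin
        2 * n + a            ≡⟨ cong (λ t → n + t + a) (+-identityʳ n) ⟩
        n + n + a            ≡⟨ cong (λ t → t + n + a) j+b≡n ⟨
        j + b + n + a        ≡⟨ rearrange j b n′ a ⟩
        b + suc E            ∎

  Δg-middle : ∀ u → n ∸ b < u → u < n ∸ a → Δ g u ≡ + (p′ * p′ * p ^ (n + u + a ∸ 2))
  Δg-middle (suc i) n∸b<1+i 1+i<n∸a = begin
    g (suc i) -ℤ g i
      ≡⟨ cong₂ _-ℤ_ (g-mid (suc i) (<∸⇒+≤ a≤n 1+i<n∸a) (≤-trans n≤i+b (n≤1+n _)))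
                    (g-mid i (≤-trans (n≤1+n _) (<∸⇒+≤ a≤n 1+i<n∸a)) n≤i+b) ⟩
    (+ (p ^ (suc i + a + n)) -ℤ + (p ^ suc E)) -ℤ (+ (p ^ (i + a + n)) -ℤ + (p ^ E))
      ≡⟨ cong (λ e → (+ (p ^ suc e) -ℤ + (p ^ suc E)) -ℤ (+ (p ^ e) -ℤ + (p ^ E))) (+-suc (i + a) n′) ⟩
    (+ (p * (p * x)) -ℤ + (p * x)) -ℤ (+ (p * x) -ℤ + x)
      ≡⟨ cong₂ _-ℤ_ (p*x-x (p * x)) (p*x-x x) ⟩
    + (p′ * (p * x)) -ℤ + (p′ * x)
      ≡⟨ cong (λ y → + y -ℤ + (p′ * x)) (x∙yz≈y∙xz p′ p x) ⟩
    + (p * (p′ * x)) -ℤ + (p′ * x)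
      ≡⟨ p*x-x (p′ * x) ⟩
    + (p′ * (p′ * x))
      ≡⟨ cong +_ (*-assoc p′ p′ x) ⟨
    + (p′ * p′ * x)
      ≡⟨ cong (λ e → + (p′ * p′ * p ^ e)) exponent ⟨
    + (p′ * p′ * p ^ (n + suc i + a ∸ 2)) ∎
    where
    open ≡-Reasoning
    E = i + a + n′
    x = p ^ E
    n≤i+b : n ≤ i + b
    n≤i+b = ∸≤⇒≤+ (≤-pred n∸b<1+i)
    exponent : n + suc i + a ∸ 2 ≡ E
    exponent = trans (cong (λ t → t + a ∸ 1) (+-suc n′ i)) (trans (+-assoc n′ i a) (+-comm n′ (i + a)))

  Δg-last : a < b → Δ g (n ∸ a) ≡ + (p′ * p ^ (2 * n ∸ 1))
  Δg-last a<b with n ∸ a in n∸a≡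
  ... | zero  = contradiction (≤-trans a<b b≤n) (≤⇒≯ (m∸n≡0⇒m≤n n∸a≡))
  ... | suc i = begin
    g (suc i) -ℤ g i
      ≡⟨ cong₂ _-ℤ_ (g-high (suc i) (≤-reflexive (sym 1+i+a≡n))) (g-mid i (≤-reflexive i+a≡n′) n≤i+b) ⟩
    (+ (p ^ (n + n)) -ℤ + y) -ℤ (+ (p ^ (i + a + n)) -ℤ + (p ^ (i + a + n′)))
      ≡⟨ cong (λ t → (+ (p ^ (n + n)) -ℤ + y) -ℤ (+ (p ^ (t + n)) -ℤ + (p ^ (t + n′)))) i+a≡n′ ⟩
    (+ (p * x) -ℤ + y) -ℤ (+ x -ℤ + y)
      ≡⟨ A-Y-[X-Y]≡A-X (+ (p * x)) (+ x) (+ y) ⟩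
    + (p * x) -ℤ + x
      ≡⟨ p*x-x x ⟩
    + (p′ * x)
      ≡⟨ cong (λ e → + (p′ * p ^ (n′ + e))) (+-identityʳ n) ⟨
    + (p′ * p ^ (2 * n ∸ 1)) ∎
    where
    open ≡-Reasoning
    x = p ^ (n′ + n)
    y = p ^ (n′ + n′)
    1+i+a≡n : suc i + a ≡ n
    1+i+a≡n = trans (cong (_+ a) (sym n∸a≡)) (m∸n+n≡m a≤n)
    i+a≡n′ : i + a ≡ n′
    i+a≡n′ = suc-injective 1+i+a≡n
    n≤i+b : n ≤ i + b
    n≤i+b = ≤-trans (≤-reflexive (trans (sym 1+i+a≡n) (sym (+-suc i a)))) (+-monoʳ-≤ i a<b)
    A-Y-[X-Y]≡A-X : ∀ A X Y → (A -ℤ Y) -ℤ (X -ℤ Y) ≡ A -ℤ X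
    A-Y-[X-Y]≡A-X = ℤ-Solver.solve-∀

  Δg≡0-off-equal : a ≡ b → ∀ j → j ≢ n ∸ a → Δ g j ≡ + 0
  Δg≡0-off-equal refl j j≢n∸a =
    Δg≡0-outside j (λ (n∸a≤j , j≤n∸a) → j≢n∸a (≤-antisym j≤n∸a n∸a≤j))

lemma5p6 : (p n : ℕ) → Prime p → ¬ (2 ∣ p) → 1 ≤ n →
    (ℓ⁰ ℓ¹ : ℕ → ℕ) → (k₀ a b : ℕ) → 1 ≤ k₀ → Coprime k₀ p → a ≤ b → b ≤ n →
    (∀ k → 1 ≤ k → ℓ⁰ k ≡ e k₀ k * ((val p k + a) ⊓ n + (val p k + b) ⊓ n)) →
    (∀ k → 1 ≤ k → ℓ¹ k ≡ e k₀ k * ((val p k + a) ⊓ (n ∸ 1) + (val p k + b) ⊓ (n ∸ 1))) →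
    (a ≡ b →
      (∀ k → 1 ≤ k → k ≢ k₀ * p ^ (n ∸ a) → λₖ p ℓ⁰ ℓ¹ k ≡ + 0)
      × λₖ p ℓ⁰ ℓ¹ (k₀ * p ^ (n ∸ a)) ≡ + (p ^ (2 * n) ∸ p ^ (2 * n ∸ 2)))
    × (a < b →
      (∀ k → 1 ≤ k → ¬ (∃[ u ] (n ∸ b ≤ u × u ≤ n ∸ a × k ≡ k₀ * p ^ u)) → λₖ p ℓ⁰ ℓ¹ k ≡ + 0)
      × λₖ p ℓ⁰ ℓ¹ (k₀ * p ^ (n ∸ b)) ≡ + ((p ∸ 1) * p ^ (2 * n + a ∸ b ∸ 1))
      × (∀ u → n ∸ b < u → u < n ∸ a → λₖ p ℓ⁰ ℓ¹ (k₀ * p ^ u) ≡ + ((p ∸ 1) * (p ∸ 1) * p ^ (n + u + a ∸ 2)))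
      × λₖ p ℓ⁰ ℓ¹ (k₀ * p ^ (n ∸ a)) ≡ + ((p ∸ 1) * p ^ (2 * n ∸ 1)))
lemma5p6 zero _ pp = contradiction pp ¬prime[0]
lemma5p6 (suc _) zero _ _ ()
lemma5p6 (suc p′) (suc n′) pp _ _ ℓ⁰ ℓ¹ k₀ a b 1≤k₀ k₀⊥p a≤b b≤n ℓ⁰≡ ℓ¹≡ =
    (λ a≡b → (λ k 1≤k k≢k₀p^[n∸a] → vanishes k 1≤k (λ j k≡k₀p^j → Δg≡0-off-equal a≡b j
                 (λ j≡n∸a → k≢k₀p^[n∸a] (trans k≡k₀p^j (cong (λ t → k₀ * p ^ t) j≡n∸a)))))
           , value (n ∸ a) (Δg-equal a≡b))
  , (λ a<b → (λ k 1≤k ∄u → vanishes k 1≤k (λ j k≡k₀p^j →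
                 Δg≡0-outside j (λ (n∸b≤j , j≤n∸a) → ∄u (j , n∸b≤j , j≤n∸a , k≡k₀p^j))))
           , value (n ∸ b) (Δg-first a<b)
           , (λ u n∸b<u u<n∸a → value u (Δg-middle u n∸b<u u<n∸a))
           , value (n ∸ a) (Δg-last a<b))
  where
  open MinProfile p′ n′ a b a≤b b≤n
  instance _ = >-nonZero 1≤k₀
  open Profile pp (prime∤coprime pp k₀⊥p) L⁰ L¹ ℓ⁰≡ ℓ¹≡ using (λₖ[k₀p^j]≡Δg; λₖ≡0-unless-Δg)
  value : ∀ j {z} → Δ g j ≡ z → λₖ p ℓ⁰ ℓ¹ (k₀ * p ^ j) ≡ z
  value j = trans (λₖ[k₀p^j]≡Δg j)
  vanishes : ∀ k → 1 ≤ k → (∀ j → k ≡ k₀ * p ^ j → Δ g j ≡ + 0) → λₖ p ℓ⁰ ℓ¹ k ≡ + 0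
  vanishes k 1≤k = λₖ≡0-unless-Δg k {{>-nonZero 1≤k}}
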